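{- Let $d\ge2$, let $\mu$ be a non-constant $d$-adic distribution on $X_n$, let $T$ be a generalized tail of $\mu$, and let $D=(D_j)_{j\in[d]}\in\mathrm{Div}(\mu)$. Then for every $j\in[d]$, $D_j$ either contains $T$ or is disjoint from $T$.
   Context: $X_n=\{x_1,\dots,x_n\}$. A distribution $\mu$ is $d$-adic if every nonzero probability is $d^{ -\ell}$ for a positive integer $\ell$. $\mathrm{Div}(\mu)$ is the set of ordered partitions $(D_1,\dots,D_d)$ of $X_n$ with $\mu(D_j)=1/d$ for all $j$. A generalized tail of $\mu$ is a largest set $T\subseteq X_n$ such that for some integer $a\ge1$: (1) $\mu(T)=d^{ -a}$; (2) $T$ contains no zero-probability elements; (3) every element of $X_n\setminus T$ has probability zero or at least $d^{ -a}$. -}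

module Defs where

open import Data.Nat as ℕ using (ℕ; zero; suc; _^_)
open import Data.Nat.Properties using (m^n≢0)
open import Data.Integer using (+_)
open import Data.Rational using (ℚ; 0ℚ; 1ℚ; _+_; _/_; _≤_)
open import Data.Fin using (Fin; zero; suc)
open import Data.Fin.Subset using (Subset; _∈_; _∉_; ⊤; ∣_∣)
open import Data.Vec using ([]; _∷_)
open import Data.Bool using (if_then_else_)
open import Data.Product using (Σ; ∃; _×_)
open import Data.Sum using (_⊎_)
open import Relation.Binary.PropositionalEquality using (_≡_; _≢_)

-- d^(-ℓ) as a rational.  (d = 0 gives a junk value; the theorem assumes d ≥ 2.)
dinv : ℕ → ℕ → ℚ
dinv zero    ℓ = 0ℚ
dinv (suc k) ℓ = _/_ (+ 1) (suc k ^ ℓ) {{m^n≢0 (suc k) ℓ}}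

mass : ∀ {n} → (Fin n → ℚ) → Subset n → ℚ
mass {zero}  μ []      = 0ℚ
mass {suc n} μ (b ∷ S) = (if b then μ zero else 0ℚ) + mass (λ i → μ (suc i)) S

IsDistribution : ∀ {n} → (Fin n → ℚ) → Set
IsDistribution {n} μ = (∀ x → 0ℚ ≤ μ x) × mass μ ⊤ ≡ 1ℚ

IsDAdic : ∀ {n} → ℕ → (Fin n → ℚ) → Set
IsDAdic d μ = ∀ x → μ x ≢ 0ℚ → Σ ℕ λ ℓ → 1 ℕ.≤ ℓ × μ x ≡ dinv d ℓ

NonConstant : ∀ {n} → (Fin n → ℚ) → Set
NonConstant μ = ∃ λ x → ∃ λ y → μ x ≢ μ y

-- T satisfies conditions (1)-(3) of a generalized tail for some a ≥ 1
TailCandidate : ∀ {n} → ℕ → (Fin n → ℚ) → Subset n → Set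
TailCandidate d μ T = Σ ℕ λ a → 1 ℕ.≤ a
  × mass μ T ≡ dinv d a
  × (∀ x → x ∈ T → μ x ≢ 0ℚ)
  × (∀ x → x ∉ T → μ x ≡ 0ℚ ⊎ dinv d a ≤ μ x)

IsGeneralizedTail : ∀ {n} → ℕ → (Fin n → ℚ) → Subset n → Set
IsGeneralizedTail d μ T =
  TailCandidate d μ T × (∀ T′ → TailCandidate d μ T′ → ∣ T′ ∣ ℕ.≤ ∣ T ∣)

IsOrderedPartition : ∀ {n d} → (Fin d → Subset n) → Set
IsOrderedPartition {n} {d} D =
  ∀ (x : Fin n) → Σ (Fin d) λ j → x ∈ D j × (∀ j′ → x ∈ D j′ → j′ ≡ j)

InDiv : ∀ {n} (d : ℕ) → (Fin n → ℚ) → (Fin d → Subset n) → Set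
InDiv d μ D = IsOrderedPartition D × (∀ j → mass μ (D j) ≡ dinv d 1)

-- If T met both D_j and its complement, μ(T ∩ D_j) would lie strictly between 0 and
-- μ(T) = d^(-a).  But every point outside T has mass 0 or d^(-ℓ) with ℓ ≤ a, so
-- μ(D_j ∖ T) is a multiple of d^(-a); so is μ(D_j) = d^(-1) = d^(a-1) · d^(-a), and hence
-- μ(D_j ∩ T) = μ(D_j) - μ(D_j ∖ T) would be one too.
module Submission where

open import Defs
open import Data.Nat using (ℕ; _≤_)
open import Data.Rational using (ℚ)
open import Data.Fin using (Fin)
open import Data.Fin.Subset using (Subset; _⊆_; _∩_; Empty)
open import Data.Sum using (_⊎_)

open import Algebra.Bundles using (CommutativeMonoid)
open import Data.Bool using (Bool; true; false; if_then_else_; _∧_; not)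
open import Data.Empty using (⊥; ⊥-elim)
open import Data.Fin using (zero; suc)
open import Data.Fin.Subset using (_∈_; ∁; Nonempty)
open import Data.Fin.Subset.Properties
  using (_∈?_; nonempty?; x∈p∩q⁺; x∈p∩q⁻; x∉p⇒x∈∁p; x∈∁p⇒x∉p; ∩-comm)
open import Data.Integer as ℤ using (+_)
import Data.Integer.Properties as ℤP
open import Data.Integer.Solver using (module +-*-Solver)
open import Data.Nat as ℕ using (zero; suc; _^_; _<_; _∸_; NonZero; z≤n; s≤s)
import Data.Nat.Properties as ℕP
open import Data.Product using (∃-syntax; _,_; proj₁; proj₂)
open import Data.Rational as ℚ using (0ℚ; _+_; _/_; toℚᵘ)
import Data.Rational.Properties as ℚP
import Data.Rational.Unnormalised as U
import Data.Rational.Unnormalised.Properties as UP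
open import Data.Sum using (inj₁; inj₂; [_,_]′)
open import Data.Vec using (_∷_; []; here; there)
open import Function using (_∘_; case_of_)
open import Relation.Binary.PropositionalEquality
open import Relation.Nullary using (yes; no)

open import Algebra.Properties.Monoid.Mult ℚP.+-0-monoid using (_×_; ×-homo-1; ×-homo-+; ×-assocˡ)
open import Algebra.Properties.CommutativeSemigroup
  (CommutativeMonoid.commutativeSemigroup ℚP.+-0-commutativeMonoid) using (interchange)

/-distribʳ-+ : ∀ a b m .{{_ : NonZero m}} → + (a ℕ.+ b) / m ≡ + a / m + + b / m
/-distribʳ-+ a b m@(suc m-1) = ℚP.toℚᵘ-injective (begin
    toℚᵘ (+ (a ℕ.+ b) / m)                   ≈⟨ ℚP.toℚᵘ-fromℚᵘ (U.mkℚᵘ (+ (a ℕ.+ b)) m-1) ⟩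
    U.mkℚᵘ (+ (a ℕ.+ b)) m-1                 ≈⟨ U.*≡* cross ⟩
    U.mkℚᵘ (+ a) m-1 U.+ U.mkℚᵘ (+ b) m-1    ≈⟨ UP.+-cong (ℚP.toℚᵘ-fromℚᵘ (U.mkℚᵘ (+ a) m-1))
                                                           (ℚP.toℚᵘ-fromℚᵘ (U.mkℚᵘ (+ b) m-1)) ⟨
    toℚᵘ (+ a / m) U.+ toℚᵘ (+ b / m)        ≈⟨ ℚP.toℚᵘ-homo-+ (+ a / m) (+ b / m) ⟨
    toℚᵘ (+ a / m + + b / m)                 ∎)
  where
  open UP.≃-Reasoning
  open +-*-Solver
  cross : + (a ℕ.+ b) ℤ.* + (m ℕ.* m) ≡ (+ a ℤ.* + m ℤ.+ + b ℤ.* + m) ℤ.* + m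
  cross rewrite ℤP.pos-+ a b | ℤP.pos-* m m =
    solve 3 (λ a b m → (a :+ b) :* (m :* m) := (a :* m :+ b :* m) :* m) refl (+ a) (+ b) (+ m)

n×[1/m]≡n/m : ∀ n m .{{_ : NonZero m}} → n × (+ 1 / m) ≡ + n / m
n×[1/m]≡n/m zero    m = sym (ℚP.0/n≡0 m)
n×[1/m]≡n/m (suc n) m = trans (cong (λ q → + 1 / m + q) (n×[1/m]≡n/m n m)) (sym (/-distribʳ-+ 1 n m))

k/[k*m]≡1/m : ∀ k m .{{_ : NonZero k}} .{{_ : NonZero m}} → (+ k / (k ℕ.* m)) {{ℕP.m*n≢0 k m}} ≡ + 1 / m
k/[k*m]≡1/m k@(suc k-1) m@(suc m-1) =
  ℚP.fromℚᵘ-cong {U.mkℚᵘ (+ k) (m-1 ℕ.+ k-1 ℕ.* m)} {U.mkℚᵘ (+ 1) m-1} (U.*≡* cross)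
  where
  cross : + k ℤ.* + m ≡ + 1 ℤ.* + (k ℕ.* m)
  cross = trans (sym (ℤP.pos-* k m)) (sym (ℤP.*-identityˡ (+ (k ℕ.* m))))

×-nonNeg : ∀ {x} n → 0ℚ ℚ.≤ x → 0ℚ ℚ.≤ n × x
×-nonNeg zero    x≥0 = ℚP.≤-refl
×-nonNeg (suc n) x≥0 = ℚP.+-mono-≤ x≥0 (×-nonNeg n x≥0)

×-monoˡ-≤ : ∀ {x m n} → 0ℚ ℚ.≤ x → m ≤ n → m × x ℚ.≤ n × x
×-monoˡ-≤ {x} {m} {n} x≥0 m≤n = begin
  m × x                  ≡⟨ ℚP.+-identityʳ (m × x) ⟨
  m × x + 0ℚ             ≤⟨ ℚP.+-monoʳ-≤ (m × x) (×-nonNeg (n ∸ m) x≥0) ⟩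
  m × x + (n ∸ m) × x    ≡⟨ ×-homo-+ x m (n ∸ m) ⟨
  (m ℕ.+ (n ∸ m)) × x    ≡⟨ cong (_× x) (ℕP.m+[n∸m]≡n m≤n) ⟩
  n × x                  ∎
  where open ℚP.≤-Reasoning

×-monoˡ-< : ∀ {x m n} → 0ℚ ℚ.< x → m < n → m × x ℚ.< n × x
×-monoˡ-< {x} {m} {n} x>0 m<n = begin-strict
  m × x         ≡⟨ ℚP.+-identityˡ (m × x) ⟨
  0ℚ + m × x    <⟨ ℚP.+-monoˡ-< (m × x) x>0 ⟩
  suc m × x     ≤⟨ ×-monoˡ-≤ (ℚP.<⇒≤ x>0) m<n ⟩
  n × x         ∎
  where open ℚP.≤-Reasoning

module _ (k : ℕ) where
  private
    d : ℕ
    d = suc k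

  dinv-suc : ∀ ℓ → dinv d ℓ ≡ d × dinv d (suc ℓ)
  dinv-suc ℓ = sym (trans (n×[1/m]≡n/m d (d ^ suc ℓ) {{ℕP.m^n≢0 d (suc ℓ)}})
                          (k/[k*m]≡1/m d (d ^ ℓ) {{_}} {{ℕP.m^n≢0 d ℓ}}))

  dinv-scale : ∀ i ℓ → dinv d ℓ ≡ (d ^ i) × dinv d (i ℕ.+ ℓ)
  dinv-scale zero    ℓ = sym (×-homo-1 (dinv d ℓ))
  dinv-scale (suc i) ℓ = begin
    dinv d ℓ                              ≡⟨ dinv-suc ℓ ⟩
    d × dinv d (suc ℓ)                    ≡⟨ cong (d ×_) (dinv-scale i (suc ℓ)) ⟩
    d × ((d ^ i) × dinv d (i ℕ.+ suc ℓ))  ≡⟨ ×-assocˡ (dinv d (i ℕ.+ suc ℓ)) d (d ^ i) ⟩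
    (d ^ suc i) × dinv d (i ℕ.+ suc ℓ)    ≡⟨ cong (λ e → (d ^ suc i) × dinv d e) (ℕP.+-suc i ℓ) ⟩
    (d ^ suc i) × dinv d (suc i ℕ.+ ℓ)    ∎
    where open ≡-Reasoning

  dinv-scale-≤ : ∀ {ℓ a} → ℓ ≤ a → dinv d ℓ ≡ (d ^ (a ∸ ℓ)) × dinv d a
  dinv-scale-≤ {ℓ} {a} ℓ≤a =
    trans (dinv-scale (a ∸ ℓ) ℓ) (cong (λ e → (d ^ (a ∸ ℓ)) × dinv d e) (ℕP.m∸n+n≡m ℓ≤a))

  dinv-pos : ∀ ℓ → 0ℚ ℚ.< dinv d ℓ
  dinv-pos ℓ = ℚP.positive⁻¹ (dinv d ℓ) {{ℚP.normalize-pos 1 (d ^ ℓ) {{ℕP.m^n≢0 d ℓ}}}}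

dinv-decreasing : ∀ k {ℓ a} → a < ℓ → dinv (suc (suc k)) ℓ ℚ.< dinv (suc (suc k)) a
dinv-decreasing k {ℓ} {a} a<ℓ = begin-strict
  dinv d ℓ                  ≡⟨ ×-homo-1 (dinv d ℓ) ⟨
  1 × dinv d ℓ              <⟨ ×-monoˡ-< (dinv-pos (suc k) ℓ) 1<d^[ℓ∸a] ⟩
  (d ^ (ℓ ∸ a)) × dinv d ℓ  ≡⟨ dinv-scale-≤ (suc k) (ℕP.<⇒≤ a<ℓ) ⟨
  dinv d a                  ∎
  where
  open ℚP.≤-Reasoning
  d : ℕ
  d = suc (suc k)
  1<d^[ℓ∸a] : 1 < d ^ (ℓ ∸ a)
  1<d^[ℓ∸a] = ℕP.^-monoʳ-< d (s≤s (s≤s z≤n)) (ℕP.m<n⇒0<n∸m a<ℓ)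

_IsMultipleOf_ : ℚ → ℚ → Set
q IsMultipleOf u = ∃[ c ] q ≡ c × u

multiple-gap : ∀ {A u} c m → 0ℚ ℚ.< A → A ℚ.< u → A + c × u ≢ m × u
multiple-gap {A} {u} c m A>0 A<u eq = [ below , above ]′ (ℕP.≤-<-connex m c)
  where
  open ℚP.≤-Reasoning
  u≥0 : 0ℚ ℚ.≤ u
  u≥0 = ℚP.<⇒≤ (ℚP.<-trans A>0 A<u)
  below : m ≤ c → ⊥
  below m≤c = ℚP.<-irrefl (sym eq) (begin-strict
    m × u        ≤⟨ ×-monoˡ-≤ u≥0 m≤c ⟩
    c × u        ≡⟨ ℚP.+-identityˡ (c × u) ⟨
    0ℚ + c × u   <⟨ ℚP.+-monoˡ-< (c × u) A>0 ⟩
    A + c × u    ∎)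
  above : c < m → ⊥
  above c<m = ℚP.<-irrefl eq (begin-strict
    A + c × u    <⟨ ℚP.+-monoˡ-< (c × u) A<u ⟩
    suc c × u    ≤⟨ ×-monoˡ-≤ u≥0 c<m ⟩
    m × u        ∎)

≤∧≢⇒< : ∀ {q} → 0ℚ ℚ.≤ q → q ≢ 0ℚ → 0ℚ ℚ.< q
≤∧≢⇒< q≥0 q≢0 = ℚP.≰⇒> (λ q≤0 → q≢0 (ℚP.≤-antisym q≤0 q≥0))

mass-split : ∀ {n} (μ : Fin n → ℚ) S T → mass μ S ≡ mass μ (S ∩ T) + mass μ (S ∩ ∁ T)
mass-split {zero}  μ []      []      = sym (ℚP.+-identityˡ 0ℚ)
mass-split {suc n} μ (s ∷ S) (t ∷ T) = begin
  h s + mass μ′ S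
    ≡⟨ cong₂ _+_ (head-split s t) (mass-split μ′ S T) ⟩
  (h (s ∧ t) + h (s ∧ not t)) + (mass μ′ (S ∩ T) + mass μ′ (S ∩ ∁ T))
    ≡⟨ interchange (h (s ∧ t)) (h (s ∧ not t)) (mass μ′ (S ∩ T)) (mass μ′ (S ∩ ∁ T)) ⟩
  (h (s ∧ t) + mass μ′ (S ∩ T)) + (h (s ∧ not t) + mass μ′ (S ∩ ∁ T))
    ∎
  where
  open ≡-Reasoning
  μ′ : Fin n → ℚ
  μ′ = μ ∘ suc
  h : Bool → ℚ
  h b = if b then μ zero else 0ℚ
  head-split : ∀ s t → h s ≡ h (s ∧ t) + h (s ∧ not t)
  head-split true  true  = sym (ℚP.+-identityʳ (μ zero))
  head-split true  false = sym (ℚP.+-identityˡ (μ zero))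
  head-split false _     = sym (ℚP.+-identityˡ 0ℚ)

mass-nonNeg : ∀ {n} {μ : Fin n → ℚ} → (∀ x → 0ℚ ℚ.≤ μ x) → ∀ S → 0ℚ ℚ.≤ mass μ S
mass-nonNeg {zero}  μ≥0 []          = ℚP.≤-refl
mass-nonNeg {suc n} μ≥0 (true  ∷ S) = ℚP.+-mono-≤ (μ≥0 zero) (mass-nonNeg (μ≥0 ∘ suc) S)
mass-nonNeg {suc n} μ≥0 (false ∷ S) = ℚP.+-mono-≤ ℚP.≤-refl (mass-nonNeg (μ≥0 ∘ suc) S)

mass-pos : ∀ {n} {μ : Fin n → ℚ} → (∀ x → 0ℚ ℚ.≤ μ x) → ∀ {S x} → x ∈ S → 0ℚ ℚ.< μ x → 0ℚ ℚ.< mass μ S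
mass-pos μ≥0 {true  ∷ S} here        μx>0 = ℚP.+-mono-<-≤ μx>0 (mass-nonNeg (μ≥0 ∘ suc) S)
mass-pos μ≥0 {true  ∷ S} (there x∈S) μx>0 = ℚP.+-mono-≤-< (μ≥0 zero) (mass-pos (μ≥0 ∘ suc) x∈S μx>0)
mass-pos μ≥0 {false ∷ S} (there x∈S) μx>0 = ℚP.+-mono-≤-< ℚP.≤-refl (mass-pos (μ≥0 ∘ suc) x∈S μx>0)

mass-multiple : ∀ {n} {μ : Fin n → ℚ} {u} S → (∀ x → x ∈ S → μ x IsMultipleOf u) → mass μ S IsMultipleOf u
mass-multiple {zero}          []          _ = 0 , refl
mass-multiple {suc n}         (false ∷ S) h =
  let c , e = mass-multiple S (λ x x∈S → h (suc x) (there x∈S)) in c , trans (ℚP.+-identityˡ _) e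
mass-multiple {suc n} {u = u} (true ∷ S)  h =
  let c₀ , e₀ = h zero here
      c  , e  = mass-multiple S (λ x x∈S → h (suc x) (there x∈S))
  in c₀ ℕ.+ c , trans (cong₂ _+_ e₀ e) (sym (×-homo-+ u c₀ c))

⊆-or-disjoint : ∀ {n} (T S : Subset n) → (Nonempty (T ∩ S) → Nonempty (T ∩ ∁ S) → ⊥) → T ⊆ S ⊎ Empty (T ∩ S)
⊆-or-disjoint T S unsplit with nonempty? (T ∩ S)
... | no  disjoint = inj₂ disjoint
... | yes meets    = inj₁ λ {x} x∈T → case x ∈? S of λ where
  (yes x∈S) → x∈S
  (no  x∉S) → ⊥-elim (unsplit meets (x , x∈p∩q⁺ (x∈T , x∉p⇒x∈∁p x∉S)))

module _ (k : ℕ) {n} {μ : Fin n → ℚ} (dadic : IsDAdic (suc (suc k)) μ) where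
  private
    d : ℕ
    d = suc (suc k)

  dadic-multiple : ∀ {a x} → dinv d a ℚ.≤ μ x → μ x IsMultipleOf dinv d a
  dadic-multiple {a} {x} dinv≤μx with dadic x (≢-sym (ℚP.<⇒≢ (ℚP.<-≤-trans (dinv-pos (suc k) a) dinv≤μx)))
  ... | ℓ , _ , μx≡dinv with ℓ ℕP.≤? a
  ...   | yes ℓ≤a = d ^ (a ∸ ℓ) , trans μx≡dinv (dinv-scale-≤ (suc k) ℓ≤a)
  ...   | no  ℓ≰a = ⊥-elim (ℚP.<-irrefl (sym μx≡dinv)
                               (ℚP.<-≤-trans (dinv-decreasing k (ℕP.≰⇒> ℓ≰a)) dinv≤μx))

  tail-candidate-unsplit : (∀ x → 0ℚ ℚ.≤ μ x) → ∀ {T} (tc : TailCandidate d μ T) S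
    → mass μ S IsMultipleOf dinv d (proj₁ tc) → Nonempty (T ∩ S) → Nonempty (T ∩ ∁ S) → ⊥
  tail-candidate-unsplit μ≥0 {T} (a , _ , massT , T≢0 , outside) S (m , massS) (y , y∈T∩S) (z , z∈T∖S) =
    multiple-gap c m inside>0 inside<u decomposition
    where
    u : ℚ
    u = dinv d a
    pos-in-T : ∀ {x} → x ∈ T → 0ℚ ℚ.< μ x
    pos-in-T x∈T = ≤∧≢⇒< (μ≥0 _) (T≢0 _ x∈T)
    inside>0 : 0ℚ ℚ.< mass μ (S ∩ T)
    inside>0 = let y∈T , y∈S = x∈p∩q⁻ T S y∈T∩S in mass-pos μ≥0 (x∈p∩q⁺ (y∈S , y∈T)) (pos-in-T y∈T)
    inside<u : mass μ (S ∩ T) ℚ.< u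
    inside<u = begin-strict
      mass μ (S ∩ T)                      ≡⟨ ℚP.+-identityʳ _ ⟨
      mass μ (S ∩ T) + 0ℚ                 <⟨ ℚP.+-monoʳ-< (mass μ (S ∩ T)) T∖S>0 ⟩
      mass μ (S ∩ T) + mass μ (T ∩ ∁ S)   ≡⟨ cong (λ R → mass μ R + mass μ (T ∩ ∁ S)) (∩-comm S T) ⟩
      mass μ (T ∩ S) + mass μ (T ∩ ∁ S)   ≡⟨ mass-split μ T S ⟨
      mass μ T                            ≡⟨ massT ⟩
      u                                   ∎
      where
      open ℚP.≤-Reasoning
      T∖S>0 : 0ℚ ℚ.< mass μ (T ∩ ∁ S)
      T∖S>0 = mass-pos μ≥0 z∈T∖S (pos-in-T (proj₁ (x∈p∩q⁻ T (∁ S) z∈T∖S)))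
    S∖T-multiple : ∀ x → x ∈ S ∩ ∁ T → μ x IsMultipleOf u
    S∖T-multiple x x∈S∖T with outside x (x∈∁p⇒x∉p (proj₂ (x∈p∩q⁻ S (∁ T) x∈S∖T)))
    ... | inj₁ μx≡0 = 0 , μx≡0
    ... | inj₂ u≤μx = dadic-multiple {a} u≤μx
    S∖T-mass : mass μ (S ∩ ∁ T) IsMultipleOf u
    S∖T-mass = mass-multiple (S ∩ ∁ T) S∖T-multiple
    c : ℕ
    c = proj₁ S∖T-mass
    decomposition : mass μ (S ∩ T) + c × u ≡ m × u
    decomposition = begin
      mass μ (S ∩ T) + c × u              ≡⟨ cong (mass μ (S ∩ T) ℚ.+_) (proj₂ S∖T-mass) ⟨
      mass μ (S ∩ T) + mass μ (S ∩ ∁ T)   ≡⟨ mass-split μ S T ⟨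
      mass μ S                            ≡⟨ massS ⟩
      m × u                               ∎
      where open ≡-Reasoning

lemma6p10 : (n d : ℕ) → 2 ≤ d → (μ : Fin n → ℚ) → IsDistribution μ → IsDAdic d μ → NonConstant μ
    → (T : Subset n) → IsGeneralizedTail d μ T
    → (D : Fin d → Subset n) → InDiv d μ D
    → ∀ (j : Fin d) → T ⊆ D j ⊎ Empty (T ∩ D j)
lemma6p10 n (suc (suc k)) (s≤s (s≤s z≤n)) μ (μ≥0 , _) dadic _ T (tc@(a , 1≤a , _) , _) D (_ , massD) j =
  ⊆-or-disjoint T (D j) (tail-candidate-unsplit k dadic μ≥0 tc (D j) block-multiple)
  where
  block-multiple : mass μ (D j) IsMultipleOf dinv (suc (suc k)) a
  block-multiple = suc (suc k) ^ (a ∸ 1) , trans (massD j) (dinv-scale-≤ (suc k) 1≤a)
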